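{- Let $R$ be a unique factorization domain and let $f(s)=\frac{a_m}{m^s}+\cdots+\frac{a_n}{n^s}$ be an algebraically primitive Dirichlet polynomial with coefficients in $R$ and $a_ma_n\neq 0$. If $\rho(m,n)=1$, then $f$ is irreducible (it cannot be written as a product of two nonconstant Dirichlet polynomials with coefficients in $R$).
   Context: Dirichlet polynomials $\sum_i \frac{a_i}{i^s}$ (finite sums, $i$ positive integers, $a_i\in R$) are multiplied by the Dirichlet product $\left(\sum_j\frac{b_j}{j^s}\right)\left(\sum_k\frac{c_k}{k^s}\right)=\sum_i\frac{\sum_{jk=i}b_jc_k}{i^s}$; a constant is one supported on $\{1\}$. The support of $f$ is the set of $i$ with $a_i\ne0$; $f$ is algebraically primitive if the integers in its support have greatest common divisor $1$. For positive integers $m,n$, the rational square root is $\rho(m,n)=\max\{\frac{d}{c}: d\mid n,\ c\mid m,\ \frac{d}{c}\le\sqrt{n/m}\}$. -}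

module Defs where

open import Level using (Level; _⊔_)
open import Algebra.Bundles using (CommutativeRing)
open import Data.Nat as ℕ using (ℕ; zero; suc; _≤_; _<_; _≤?_)
open import Data.Nat.Divisibility using (_∣_; _∣?_)
open import Data.Nat.DivMod using (_/_)
open import Data.Integer using (+_)
open import Data.Rational as ℚ using (ℚ; 0ℚ)
open import Data.Bool using (Bool; if_then_else_; _∧_)
open import Data.List using (List; []; _∷_; foldr; map; upTo; concatMap)
open import Data.List.Relation.Unary.All using (All)
open import Data.List.Relation.Binary.Pointwise using (Pointwise)
open import Data.List.Relation.Binary.Permutation.Propositional using (_↭_)
open import Data.Product using (Σ; ∃; _×_)
open import Data.Sum using (_⊎_)
open import Relation.Nullary using (¬_; does)
open import Relation.Binary.PropositionalEquality using (_≡_)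

module _ {c ℓ : Level} (R : CommutativeRing c ℓ) where
  open CommutativeRing R

  IsUnit : Carrier → Set (c ⊔ ℓ)
  IsUnit x = ∃ λ y → x * y ≈ 1#

  IsIrreducibleElt : Carrier → Set (c ⊔ ℓ)
  IsIrreducibleElt x =
    (¬ x ≈ 0#) × (¬ IsUnit x) × (∀ a b → x ≈ a * b → IsUnit a ⊎ IsUnit b)

  Associated : Carrier → Carrier → Set (c ⊔ ℓ)
  Associated x y = ∃ λ u → IsUnit u × x ≈ u * y

  prodR : List Carrier → Carrier
  prodR = foldr _*_ 1#

  record IsUFD : Set (c ⊔ ℓ) where
    field
      nontrivial     : ¬ 1# ≈ 0#
      noZeroDivisors : ∀ x y → x * y ≈ 0# → x ≈ 0# ⊎ y ≈ 0#
      factorization  : ∀ x → ¬ x ≈ 0# → ¬ IsUnit x →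
                       ∃ λ ps → All IsIrreducibleElt ps × x ≈ prodR ps
      uniqueness     : ∀ ps qs → All IsIrreducibleElt ps → All IsIrreducibleElt qs →
                       prodR ps ≈ prodR qs →
                       ∃ λ qs′ → (qs′ ↭ qs) × Pointwise Associated ps qs′

-- Dirichlet polynomials over R, represented by their coefficient
-- function i ↦ a_i (only positive indices i ≥ 1 are meaningful).

  IsDirichletPoly : (ℕ → Carrier) → Set ℓ
  IsDirichletPoly a = ∃ λ N → ∀ i → N < i → a i ≈ 0#

  sumR : ℕ → (ℕ → Carrier) → Carrier
  sumR zero    t = 0#
  sumR (suc k) t = sumR k t + t (suc k)

  -- Dirichlet product: (b ⋆ c)_i = Σ_{j k = i} b_j c_k  (for i ≥ 1)
  _⋆_ : (ℕ → Carrier) → (ℕ → Carrier) → (ℕ → Carrier)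
  (b ⋆ d) i = sumR i λ where
    zero    → 0#
    (suc j) → if does (suc j ∣? i) then b (suc j) * d (i / suc j) else 0#

  -- nonconstant: support not contained in {1}
  NonConstant : (ℕ → Carrier) → Set ℓ
  NonConstant a = ∃ λ i → 2 ≤ i × ¬ a i ≈ 0#

  -- f = a_m/m^s + ... + a_n/n^s : support of a contained in [m, n]
  SupportIn : (ℕ → Carrier) → ℕ → ℕ → Set ℓ
  SupportIn a m n = ∀ i → ¬ a i ≈ 0# → m ≤ i × i ≤ n

  -- algebraically primitive: the gcd of the (positive) support is 1,
  -- i.e. every common divisor of the support equals 1
  AlgPrimitive : (ℕ → Carrier) → Set ℓ
  AlgPrimitive a = ∀ d → (∀ i → 1 ≤ i → ¬ a i ≈ 0# → d ∣ i) → d ≡ 1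

  DPIrreducible : (ℕ → Carrier) → Set (c ⊔ ℓ)
  DPIrreducible f = ¬ (Σ (ℕ → Carrier) λ g → Σ (ℕ → Carrier) λ h →
    IsDirichletPoly g × IsDirichletPoly h × NonConstant g × NonConstant h ×
    (∀ i → 1 ≤ i → f i ≈ (g ⋆ h) i))

-- rational square root
-- ρ(m,n) = max { d/c : d ∣ n, c ∣ m, d/c ≤ √(n/m) }, for m, n ≥ 1.
-- For positive integers, d/c ≤ √(n/m)  ⇔  d² m ≤ c² n.

ρ-candidates : ℕ → ℕ → List ℚ
ρ-candidates m n =
  concatMap (λ d → concatMap (λ k →
      if does (d ∣? n) ∧ does (suc k ∣? m) ∧ does (d ℕ.* d ℕ.* m ≤? suc k ℕ.* suc k ℕ.* n)
      then (+ d ℚ./ suc k) ∷ [] else [])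
    (upTo m))
  (map suc (upTo n))

ρ : ℕ → ℕ → ℚ
ρ m n = foldr ℚ._⊔_ 0ℚ (ρ-candidates m n)

{-# OPTIONS --safe #-}
-- Let f = g ⋆ h with g, h nonconstant, g running from m₁ to n₁ and h from m₂ to n₂. Over a
-- domain the extreme terms multiply without cancelling, so m = m₁ m₂ and n = n₁ n₂. Since
-- (n₁/m₁)(n₂/m₂) = n/m, one of the two ratios, say n₁/m₁, is at most √(n/m); as n₁ ∣ n and
-- m₁ ∣ m it is a candidate for ρ(m,n) = 1, so n₁ ≤ m₁ and g is a monomial g_{m₁}/m₁ˢ. Then
-- every index in the support of f is a multiple of m₁, so m₁ = 1 by primitivity and g is
-- constant after all.
module Submission where

open import Defs hiding (_⋆_)
import Defs
open import Level using (_⊔_)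
open import Algebra.Bundles using (CommutativeRing)
open import Data.Nat as ℕ
  using (ℕ; zero; suc; _≤_; _<_; _≤?_; z≤n; z<s; NonZero; >-nonZero; ≢-nonZero⁻¹)
open import Data.Nat.Properties as ℕ
  using ( ≤-refl; ≤-trans; ≤-antisym; ≤-pred; <-≤-trans; ≤-<-trans; ≤-total; ≮⇒≥; ≰⇒>; <⇒≢; >⇒≢
        ; <⇒≤; <⇒≱; ≤∧≢⇒<; m≤n⇒m<n∨m≡n; m<n⇒m<1+n; *-mono-≤; *-monoʳ-≤; *-monoˡ-<; suc-injective
        ; _≟_; *-cancelˡ-≡; module ≤-Reasoning )
open import Data.Nat.Divisibility
  using (_∣_; _∣?_; _∣0; m∣m*n; n∣m*n; ∣m⇒∣m*n; ∣n⇒∣m*n; ∣-reflexive; ∣⇒≤; 0∣⇒≡0)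
open import Data.Nat.DivMod using (_/_; m*[n/m]≡n)
open import Data.Nat.Tactic.RingSolver using (solve-∀)
open import Data.Integer as ℤ using (+_)
import Data.Integer.Properties as ℤ
open import Data.Integer.GCD using (gcd)
open import Data.Rational as ℚ using (0ℚ; 1ℚ; ↥_; ↧_)
import Data.Rational.Properties as ℚ
open import Data.Bool using (if_then_else_; _∧_)
open import Data.List using ([]; _∷_; foldr)
open import Data.List.Membership.Propositional using (_∈_)
open import Data.List.Membership.Propositional.Properties using (∈-upTo⁺; ∈-map⁺; ∈-concat⁺′)
open import Data.List.Relation.Unary.Any using (here; there)
open import Data.Product using (∃; ∃₂; _×_; _,_; proj₁; proj₂)
open import Data.Sum as Sum using (_⊎_; inj₁; inj₂; [_,_])
open import Effect.Monad using (RawMonad)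
open import Function using (_∘_; const)
open import Relation.Nullary using (¬_; Dec; yes; no; does; contradiction; _×-dec_)
open import Relation.Nullary.Decidable using (dec-true; decidable-stable; ¬¬-excluded-middle)
open import Relation.Nullary.Negation using (¬¬-Monad)
open import Relation.Binary.PropositionalEquality as ≡ using (_≡_; _≢_; refl; cong; subst; subst₂)

∈⇒≤foldr-⊔ : ∀ {x xs} → x ∈ xs → x ℚ.≤ foldr ℚ._⊔_ 0ℚ xs
∈⇒≤foldr-⊔ {x} (here refl) = ℚ.p≤p⊔q x _
∈⇒≤foldr-⊔ {xs = y ∷ _} (there x∈xs) = ℚ.≤-trans (∈⇒≤foldr-⊔ x∈xs) (ℚ.p≤q⊔p y _)

divisor-ratio≤ρ : ∀ {m n c d} .{{_ : NonZero m}} .{{_ : NonZero n}} →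
  suc d ∣ n → suc c ∣ m → suc d ℕ.* suc d ℕ.* m ≤ suc c ℕ.* suc c ℕ.* n →
  (+ suc d ℚ./ suc c) ℚ.≤ ρ m n
divisor-ratio≤ρ {m} {n} {c} {d} d∣n c∣m d²m≤c²n = ∈⇒≤foldr-⊔
  (∈-concat⁺′ (∈-concat⁺′ selected (∈-map⁺ _ (∈-upTo⁺ (∣⇒≤ c∣m))))
              (∈-map⁺ _ (∈-map⁺ suc (∈-upTo⁺ (∣⇒≤ d∣n)))))
  where
  selected : (+ suc d ℚ./ suc c) ∈
    (if does (suc d ∣? n) ∧ does (suc c ∣? m) ∧ does (suc d ℕ.* suc d ℕ.* m ≤? suc c ℕ.* suc c ℕ.* n)
     then (+ suc d ℚ./ suc c) ∷ [] else [])
  selected rewrite dec-true (suc d ∣? n) d∣n | dec-true (suc c ∣? m) c∣m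
                 | dec-true (_ ≤? _) d²m≤c²n = here refl

/≤1⇒≤ : ∀ d c → (+ d ℚ./ suc c) ℚ.≤ 1ℚ → d ≤ suc c
/≤1⇒≤ d c (ℚ.*≤* ↥x*1≤1*↧x) = ℤ.drop‿+≤+ (begin
  + d              ≡⟨ ℚ.↥-/ (+ d) (suc c) ⟨
  ↥ x ℤ.* common   ≤⟨ ℤ.*-monoʳ-≤-nonNeg common ↥x≤↧x ⟩
  ↧ x ℤ.* common   ≡⟨ ℚ.↧-/ (+ d) (suc c) ⟩
  + suc c          ∎)
  where
  open ℤ.≤-Reasoning
  x = + d ℚ./ suc c
  common = gcd (+ d) (+ suc c)
  ↥x≤↧x : ↥ x ℤ.≤ ↧ x
  ↥x≤↧x = subst₂ ℤ._≤_ (ℤ.*-identityʳ (↥ x)) (ℤ.*-identityˡ (↧ x)) ↥x*1≤1*↧x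

ρ≡1⇒divisor-ratio≤1 : ∀ {m n c d} .{{_ : NonZero m}} .{{_ : NonZero n}} → ρ m n ≡ 1ℚ →
  d ∣ n → c ∣ m → d ℕ.* d ℕ.* m ≤ c ℕ.* c ℕ.* n → d ≤ c
ρ≡1⇒divisor-ratio≤1 {m} {c = zero} _ _ 0∣m _ = contradiction (0∣⇒≡0 0∣m) (≢-nonZero⁻¹ m)
ρ≡1⇒divisor-ratio≤1 {d = zero} _ _ _ _ = z≤n
ρ≡1⇒divisor-ratio≤1 {c = suc c} {suc d} ρ≡1 d∣n c∣m d²m≤c²n =
  /≤1⇒≤ (suc d) c (subst (_ ℚ.≤_) ρ≡1 (divisor-ratio≤ρ d∣n c∣m d²m≤c²n))

square-bound : ∀ m₁ n₁ m₂ n₂ → n₁ ℕ.* m₂ ≤ m₁ ℕ.* n₂ →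
  n₁ ℕ.* n₁ ℕ.* (m₁ ℕ.* m₂) ≤ m₁ ℕ.* m₁ ℕ.* (n₁ ℕ.* n₂)
square-bound m₁ n₁ m₂ n₂ n₁m₂≤m₁n₂ = begin
  n₁ ℕ.* n₁ ℕ.* (m₁ ℕ.* m₂)    ≡⟨ left-form n₁ m₁ m₂ ⟩
  n₁ ℕ.* m₁ ℕ.* (n₁ ℕ.* m₂)    ≤⟨ *-monoʳ-≤ (n₁ ℕ.* m₁) n₁m₂≤m₁n₂ ⟩
  n₁ ℕ.* m₁ ℕ.* (m₁ ℕ.* n₂)    ≡⟨ right-form n₁ m₁ n₂ ⟨
  m₁ ℕ.* m₁ ℕ.* (n₁ ℕ.* n₂)    ∎
  where
  open ≤-Reasoning
  left-form : ∀ a b e → a ℕ.* a ℕ.* (b ℕ.* e) ≡ a ℕ.* b ℕ.* (a ℕ.* e)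
  left-form = solve-∀
  right-form : ∀ a b e → b ℕ.* b ℕ.* (a ℕ.* e) ≡ a ℕ.* b ℕ.* (b ℕ.* e)
  right-form = solve-∀

one-ratio-below-sqrt : ∀ m₁ n₁ m₂ n₂ →
  n₁ ℕ.* n₁ ℕ.* (m₁ ℕ.* m₂) ≤ m₁ ℕ.* m₁ ℕ.* (n₁ ℕ.* n₂) ⊎
  n₂ ℕ.* n₂ ℕ.* (m₁ ℕ.* m₂) ≤ m₂ ℕ.* m₂ ℕ.* (n₁ ℕ.* n₂)
one-ratio-below-sqrt m₁ n₁ m₂ n₂ with ≤-total (n₁ ℕ.* m₂) (m₁ ℕ.* n₂)
... | inj₁ n₁m₂≤m₁n₂ = inj₁ (square-bound m₁ n₁ m₂ n₂ n₁m₂≤m₁n₂)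
... | inj₂ m₁n₂≤n₁m₂ = inj₂ (subst₂ _≤_
  (cong (n₂ ℕ.* n₂ ℕ.*_) (ℕ.*-comm m₂ m₁)) (cong (m₂ ℕ.* m₂ ℕ.*_) (ℕ.*-comm n₂ n₁))
  (square-bound m₂ n₂ m₁ n₁ (subst₂ _≤_ (ℕ.*-comm m₁ n₂) (ℕ.*-comm n₁ m₂) m₁n₂≤n₁m₂)))

module _ {p} (Z : ℕ → Set p) where
  open RawMonad (¬¬-Monad {p})

  private
    extend-below : ∀ {k} → (∀ j → j < k → Z j) → Z k → ∀ j → j < suc k → Z j
    extend-below {k} Z<k Zk j j<1+k with m≤n⇒m<n∨m≡n (≤-pred j<1+k)
    ... | inj₁ j<k = Z<k j j<k
    ... | inj₂ refl = Zk

    extend-above : ∀ {k} → (∀ j → k < j → Z j) → Z k → ∀ j → k ≤ j → Z j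
    extend-above {k} Z>k Zk j k≤j with m≤n⇒m<n∨m≡n k≤j
    ... | inj₁ k<j = Z>k j k<j
    ... | inj₂ refl = Zk

  ¬¬-first-failure : ∀ k →
    ¬ ¬ ((∀ j → j < k → Z j) ⊎ ∃ λ m → m < k × ¬ Z m × ∀ j → j < m → Z j)
  ¬¬-first-failure zero = pure (inj₁ λ _ ())
  ¬¬-first-failure (suc k) = do
    inj₁ Z<k ← ¬¬-first-failure k
      where inj₂ (m , m<k , ¬Zm , Z<m) → pure (inj₂ (m , m<n⇒m<1+n m<k , ¬Zm , Z<m))
    yes Zk ← ¬¬-excluded-middle
      where no ¬Zk → pure (inj₂ (k , ≤-refl , ¬Zk , Z<k))
    pure (inj₁ (extend-below Z<k Zk))

  ¬¬-least-failure : ∀ {i} → ¬ Z i →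
    ¬ ¬ ∃ λ m → m ≤ i × ¬ Z m × ∀ j → j < m → Z j
  ¬¬-least-failure {i} ¬Zi = do
    inj₂ (m , m<1+i , ¬Zm , Z<m) ← ¬¬-first-failure (suc i)
      where inj₁ Z≤i → contradiction (Z≤i i ≤-refl) ¬Zi
    pure (m , ≤-pred m<1+i , ¬Zm , Z<m)

  ¬¬-greatest-failure : ∀ N {i} → (∀ j → N < j → Z j) → ¬ Z i →
    ¬ ¬ ∃ λ n → i ≤ n × ¬ Z n × ∀ j → n < j → Z j
  ¬¬-greatest-failure N {i} Z>N ¬Zi = do
    yes ZN ← ¬¬-excluded-middle
      where no ¬ZN → pure (N , ≮⇒≥ (λ N<i → ¬Zi (Z>N i N<i)) , ¬ZN , Z>N)
    lower N (extend-above Z>N ZN)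
    where
    lower : ∀ N → (∀ j → N ≤ j → Z j) → ¬ ¬ ∃ λ n → i ≤ n × ¬ Z n × ∀ j → n < j → Z j
    lower zero Z≥0 = contradiction (Z≥0 i z≤n) ¬Zi
    lower (suc N) Z>N = ¬¬-greatest-failure N Z>N ¬Zi

factors-positive : ∀ {j q i} → j ℕ.* q ≡ i → 0 < i → 0 < j × 0 < q
factors-positive {suc _} {suc _} _ _ = z<s , z<s
factors-positive {zero} refl ()
factors-positive {suc j} {zero} refl 0<j*0 rewrite ℕ.*-zeroʳ j = contradiction 0<j*0 λ ()

module DirichletProduct {c ℓ} (R : CommutativeRing c ℓ) where
  open CommutativeRing R renaming (refl to ≈-refl)
  open import Relation.Binary.Reasoning.Setoid setoid

  infixl 7 _⋆_
  _⋆_ : (ℕ → Carrier) → (ℕ → Carrier) → ℕ → Carrier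
  _⋆_ = Defs._⋆_ R

  NoZeroDivisors : Set (c ⊔ ℓ)
  NoZeroDivisors = ∀ x y → x * y ≈ 0# → x ≈ 0# ⊎ y ≈ 0#

  sumR-vanishes : ∀ k t → (∀ j → j < k → t (suc j) ≈ 0#) → sumR R k t ≈ 0#
  sumR-vanishes zero    t _  = ≈-refl
  sumR-vanishes (suc k) t t≈0 = begin
    sumR R k t + t (suc k) ≈⟨ +-cong (sumR-vanishes k t λ j j<k → t≈0 j (m<n⇒m<1+n j<k))
                                     (t≈0 k ≤-refl) ⟩
    0# + 0#                ≈⟨ +-identityʳ 0# ⟩
    0#                     ∎

  sumR-single : ∀ k t {j} → j < k → (∀ j′ → j′ < k → j′ ≢ j → t (suc j′) ≈ 0#) →
    sumR R k t ≈ t (suc j)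
  sumR-single (suc k) t {j} j<1+k others with j ≟ k
  ... | yes ≡.refl = begin
    sumR R k t + t (suc k) ≈⟨ +-congʳ (sumR-vanishes k t λ j′ j′<k →
                                         others j′ (m<n⇒m<1+n j′<k) (<⇒≢ j′<k)) ⟩
    0# + t (suc k)         ≈⟨ +-identityˡ _ ⟩
    t (suc k)              ∎
  ... | no j≢k = begin
    sumR R k t + t (suc k) ≈⟨ +-cong (sumR-single k t j<k λ j′ j′<k → others j′ (m<n⇒m<1+n j′<k))
                                     (others k ≤-refl λ k≡j → j≢k (≡.sym k≡j)) ⟩
    t (suc j) + 0#         ≈⟨ +-identityʳ _ ⟩
    t (suc j)              ∎
    where
    j<k : j < k
    j<k = ≤∧≢⇒< (ℕ.≤-pred j<1+k) j≢k

  ⋆-summand : (ℕ → Carrier) → (ℕ → Carrier) → ℕ → ℕ → Carrier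
  ⋆-summand g h i j = if does (suc j ∣? i) then g (suc j) * h (i / suc j) else 0#

  -- does (suc j ∣? i) computes to a test on a remainder, so 'with suc j ∣? i' cannot abstract
  -- it in the goal; these two lemmas receive the decision as an argument instead.
  if-does-vanishes : ∀ {a} {A : Set a} (a? : Dec A) {x} → (A → x ≈ 0#) →
    (if does a? then x else 0#) ≈ 0#
  if-does-vanishes (yes a) x≈0 = x≈0 a
  if-does-vanishes (no  _) _   = ≈-refl

  if-does-holds : ∀ {a} {A : Set a} (a? : Dec A) {x} → A → (if does a? then x else 0#) ≈ x
  if-does-holds (yes _) _ = ≈-refl
  if-does-holds (no ¬a) a = contradiction a ¬a

  ⋆-summand-vanishes : ∀ g h i j → (suc j ∣ i → g (suc j) * h (i / suc j) ≈ 0#) →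
    ⋆-summand g h i j ≈ 0#
  ⋆-summand-vanishes g h i j = if-does-vanishes (suc j ∣? i)

  ⋆-vanishes : ∀ g h i → (∀ j q → j ℕ.* q ≡ i → g j * h q ≈ 0#) → (g ⋆ h) i ≈ 0#
  ⋆-vanishes g h i terms≈0 = sumR-vanishes i _ λ j _ →
    ⋆-summand-vanishes g h i j λ j∣i → terms≈0 (suc j) (i / suc j) (m*[n/m]≡n j∣i)

  ⋆-single : ∀ g h {i j q} → j ℕ.* q ≡ i → 0 < i →
    (∀ j′ q′ → j′ ℕ.* q′ ≡ i → j′ ≢ j → g j′ * h q′ ≈ 0#) → (g ⋆ h) i ≈ g j * h q
  ⋆-single g h {j = zero} ≡.refl ()
  ⋆-single g h {i} {suc j} {q} j*q≡i 0<i others = begin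
    (g ⋆ h) i                    ≈⟨ sumR-single i _ (∣⇒≤ {{>-nonZero 0<i}} j∣i) other-summands ⟩
    ⋆-summand g h i j            ≈⟨ if-does-holds (suc j ∣? i) j∣i ⟩
    g (suc j) * h (i / suc j)    ≡⟨ ≡.cong (λ q′ → g (suc j) * h q′) i/j≡q ⟩
    g (suc j) * h q              ∎
    where
    j∣i : suc j ∣ i
    j∣i = ≡.subst (suc j ∣_) j*q≡i (m∣m*n q)
    i/j≡q : i / suc j ≡ q
    i/j≡q = *-cancelˡ-≡ (i / suc j) q (suc j) (≡.trans (m*[n/m]≡n j∣i) (≡.sym j*q≡i))
    other-summands : ∀ j′ → j′ < i → j′ ≢ j → ⋆-summand g h i j′ ≈ 0#
    other-summands j′ _ j′≢j = ⋆-summand-vanishes g h i j′ λ j′∣i →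
      others (suc j′) (i / suc j′) (m*[n/m]≡n j′∣i) (j′≢j ∘ suc-injective)

  *-vanishesˡ : ∀ {x} y → x ≈ 0# → x * y ≈ 0#
  *-vanishesˡ y x≈0 = trans (*-congʳ x≈0) (zeroˡ y)

  *-vanishesʳ : ∀ x {y} → y ≈ 0# → x * y ≈ 0#
  *-vanishesʳ x y≈0 = trans (*-congˡ y≈0) (zeroʳ x)

  -- Index 0 carries no coefficient of a Dirichlet polynomial, so nothing is asked of g 0.
  record Spans (g : ℕ → Carrier) (low high : ℕ) : Set ℓ where
    field
      low-positive : 0 < low
      low≉0        : ¬ g low ≈ 0#
      high≉0       : ¬ g high ≈ 0#
      below-low    : ∀ j → 0 < j → j < low → g j ≈ 0#
      above-high   : ∀ j → high < j → g j ≈ 0#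

    low≤high : low ≤ high
    low≤high = ≮⇒≥ λ high<low → low≉0 (above-high low high<low)

    vanishes-outside : ∀ j → 0 < j → ¬ (low ≤ j × j ≤ high) → g j ≈ 0#
    vanishes-outside j 0<j j∉[low,high] with low ≤? j | j ≤? high
    ... | no low≰j  | _         = below-low j 0<j (≰⇒> low≰j)
    ... | yes _     | no j≰high = above-high j (≰⇒> j≰high)
    ... | yes low≤j | yes j≤high = contradiction (low≤j , j≤high) j∉[low,high]

  open Spans

  module _ {g h m₁ n₁ m₂ n₂} (g-spans : Spans g m₁ n₁) (h-spans : Spans h m₂ n₂) where

    private
      InBox : ℕ → ℕ → Set
      InBox j q = (m₁ ≤ j × j ≤ n₁) × (m₂ ≤ q × q ≤ n₂)

      term-vanishes : ∀ {i j q} → j ℕ.* q ≡ i → 0 < i → ¬ InBox j q → g j * h q ≈ 0#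
      term-vanishes {j = j} {q} j*q≡i 0<i ¬box
        with factors-positive j*q≡i 0<i | (m₁ ≤? j) ×-dec (j ≤? n₁)
      ... | 0<j , _   | no j∉  = *-vanishesˡ (h q) (vanishes-outside g-spans j 0<j j∉)
      ... | _   , 0<q | yes j∈ = *-vanishesʳ (g j) (vanishes-outside h-spans q 0<q λ q∈ → ¬box (j∈ , q∈))

    ⋆-below : ∀ i → 0 < i → i < m₁ ℕ.* m₂ → (g ⋆ h) i ≈ 0#
    ⋆-below i 0<i i<m₁m₂ = ⋆-vanishes g h i λ j q j*q≡i → term-vanishes j*q≡i 0<i
      λ ((m₁≤j , _) , (m₂≤q , _)) → <⇒≱ i<m₁m₂ (≡.subst (m₁ ℕ.* m₂ ≤_) j*q≡i (*-mono-≤ m₁≤j m₂≤q))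

    ⋆-above : ∀ i → n₁ ℕ.* n₂ < i → (g ⋆ h) i ≈ 0#
    ⋆-above i n₁n₂<i = ⋆-vanishes g h i λ j q j*q≡i → term-vanishes j*q≡i (≤-<-trans z≤n n₁n₂<i)
      λ ((_ , j≤n₁) , (_ , q≤n₂)) → <⇒≱ n₁n₂<i (≡.subst (_≤ n₁ ℕ.* n₂) j*q≡i (*-mono-≤ j≤n₁ q≤n₂))

    ⋆-at-low : (g ⋆ h) (m₁ ℕ.* m₂) ≈ g m₁ * h m₂
    ⋆-at-low = ⋆-single g h refl 0<m₁m₂ λ j q j*q≡m₁m₂ j≢m₁ → term-vanishes j*q≡m₁m₂ 0<m₁m₂
      λ ((m₁≤j , _) , (m₂≤q , _)) → <⇒≢ (<-≤-trans
        (*-monoˡ-< m₂ {{>-nonZero (low-positive h-spans)}} (≤∧≢⇒< m₁≤j (j≢m₁ ∘ ≡.sym)))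
        (*-monoʳ-≤ j m₂≤q)) (≡.sym j*q≡m₁m₂)
      where
      0<m₁m₂ : 0 < m₁ ℕ.* m₂
      0<m₁m₂ = *-mono-≤ (low-positive g-spans) (low-positive h-spans)

    ⋆-at-high : (g ⋆ h) (n₁ ℕ.* n₂) ≈ g n₁ * h n₂
    ⋆-at-high = ⋆-single g h refl 0<n₁n₂ λ j q j*q≡n₁n₂ j≢n₁ → term-vanishes j*q≡n₁n₂ 0<n₁n₂
      λ ((_ , j≤n₁) , (_ , q≤n₂)) → <⇒≢ (<-≤-trans
        (*-monoˡ-< q {{>-nonZero (proj₂ (factors-positive {j} j*q≡n₁n₂ 0<n₁n₂))}} (≤∧≢⇒< j≤n₁ j≢n₁))
        (*-monoʳ-≤ n₁ q≤n₂)) j*q≡n₁n₂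
      where
      0<n₁n₂ : 0 < n₁ ℕ.* n₂
      0<n₁n₂ = *-mono-≤ (≤-trans (low-positive g-spans) (low≤high g-spans))
                        (≤-trans (low-positive h-spans) (low≤high h-spans))

    ⋆-spans : NoZeroDivisors → Spans (g ⋆ h) (m₁ ℕ.* m₂) (n₁ ℕ.* n₂)
    ⋆-spans no-zero-divisors = record
      { low-positive = *-mono-≤ (low-positive g-spans) (low-positive h-spans)
      ; low≉0        = product≉0 (low≉0 g-spans) (low≉0 h-spans) ∘ trans (sym ⋆-at-low)
      ; high≉0       = product≉0 (high≉0 g-spans) (high≉0 h-spans) ∘ trans (sym ⋆-at-high)
      ; below-low    = ⋆-below
      ; above-high   = ⋆-above
      }
      where
      product≉0 : ∀ {x y} → ¬ x ≈ 0# → ¬ y ≈ 0# → ¬ x * y ≈ 0#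
      product≉0 {x} {y} x≉0 y≉0 xy≈0 = [ x≉0 , y≉0 ] (no-zero-divisors x y xy≈0)

  SupportedOnMultiplesOf : ℕ → (ℕ → Carrier) → Set ℓ
  SupportedOnMultiplesOf k g = ∀ j → ¬ k ∣ j → g j ≈ 0#

  spans-monomial : ∀ {g k l} → Spans g k l → l ≤ k → SupportedOnMultiplesOf k g
  spans-monomial {k = k} _ _ zero k∤0 = contradiction (k ∣0) k∤0
  spans-monomial {k = k} spans l≤k j@(suc _) k∤j = vanishes-outside spans j z<s
    λ (k≤j , j≤l) → k∤j (∣-reflexive (≤-antisym k≤j (≤-trans j≤l l≤k)))

  ⋆-supportedOnMultiplesˡ : ∀ {k} g h → SupportedOnMultiplesOf k g →
    SupportedOnMultiplesOf k (g ⋆ h)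
  ⋆-supportedOnMultiplesˡ {k} g h g-multiples i k∤i = ⋆-vanishes g h i λ j q j*q≡i →
    *-vanishesˡ (h q) (g-multiples j λ k∣j → k∤i (≡.subst (k ∣_) j*q≡i (∣m⇒∣m*n q k∣j)))

  ⋆-supportedOnMultiplesʳ : ∀ {k} g h → SupportedOnMultiplesOf k h →
    SupportedOnMultiplesOf k (g ⋆ h)
  ⋆-supportedOnMultiplesʳ {k} g h h-multiples i k∤i = ⋆-vanishes g h i λ j q j*q≡i →
    *-vanishesʳ (g j) (h-multiples q λ k∣q → k∤i (≡.subst (k ∣_) j*q≡i (∣n⇒∣m*n j k∣q)))

  algPrimitive-supportedOnMultiples : ∀ {a b k} → AlgPrimitive R a → (∀ i → 0 < i → a i ≈ b i) →
    SupportedOnMultiplesOf k b → k ≡ 1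
  algPrimitive-supportedOnMultiples {k = k} prim a≈b b-multiples = prim k λ i 0<i aᵢ≉0 →
    decidable-stable (k ∣? i) λ k∤i → aᵢ≉0 (trans (a≈b i 0<i) (b-multiples i k∤i))

  ends-agree : ∀ {a b m n low high} → (∀ i → 0 < i → a i ≈ b i) → SupportIn R a m n → 0 < m →
    ¬ a m ≈ 0# → ¬ a n ≈ 0# → Spans b low high → m ≡ low × n ≡ high
  ends-agree {a} {b} {m} {n} {low} {high} a≈b support 0<m aₘ≉0 aₙ≉0 spans =
      ≤-antisym (proj₁ (support low (a≉0 low 0<low (low≉0 spans))))
                (≮⇒≥ λ m<low → aₘ≉0 (trans (a≈b m 0<m) (below-low spans m 0<m m<low)))
    , ≤-antisym (≮⇒≥ λ high<n → aₙ≉0 (trans (a≈b n 0<n) (above-high spans n high<n)))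
                (proj₂ (support high (a≉0 high 0<high (high≉0 spans))))
    where
    a≉0 : ∀ i → 0 < i → ¬ b i ≈ 0# → ¬ a i ≈ 0#
    a≉0 i 0<i bᵢ≉0 aᵢ≈0 = bᵢ≉0 (trans (sym (a≈b i 0<i)) aᵢ≈0)
    0<low : 0 < low
    0<low = low-positive spans
    0<high : 0 < high
    0<high = ≤-trans 0<low (low≤high spans)
    0<n : 0 < n
    0<n = ≤-trans 0<m (proj₂ (support m aₘ≉0))

  ¬¬-spans : ∀ {g i} → IsDirichletPoly R g → 0 < i → ¬ g i ≈ 0# →
    ¬ ¬ ∃₂ λ low high → low ≤ i × i ≤ high × Spans g low high
  ¬¬-spans {g} {i} (N , g-vanishes) 0<i gᵢ≉0 = do
    (low , low≤i , ¬Zlow , Z<low) ← ¬¬-least-failure Z ¬Zi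
    (high , i≤high , ¬Zhigh , Z>high) ← ¬¬-greatest-failure Z N (λ j N<j _ → g-vanishes j N<j) ¬Zi
    pure (low , high , low≤i , i≤high , record
      { low-positive = positive ¬Zlow
      ; low≉0        = ¬Zlow ∘ const
      ; high≉0       = ¬Zhigh ∘ const
      ; below-low    = λ j 0<j j<low → Z<low j j<low 0<j
      ; above-high   = λ j high<j → Z>high j high<j (≤-<-trans z≤n high<j)
      })
    where
    open RawMonad (¬¬-Monad {ℓ})
    Z : ℕ → Set ℓ
    Z j = 0 < j → g j ≈ 0#
    ¬Zi : ¬ Z i
    ¬Zi Zi = gᵢ≉0 (Zi 0<i)
    positive : ∀ {j} → ¬ Z j → 0 < j
    positive {zero}  ¬Z0 = contradiction (λ ()) ¬Z0
    positive {suc _} _   = z<s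

  one-factor-constant : ∀ {a m n g h m₁ n₁ m₂ n₂} →
    NoZeroDivisors → AlgPrimitive R a → ρ m n ≡ 1ℚ →
    0 < m → SupportIn R a m n → ¬ a m ≈ 0# → ¬ a n ≈ 0# →
    (∀ i → 0 < i → a i ≈ (g ⋆ h) i) → Spans g m₁ n₁ → Spans h m₂ n₂ → n₁ ≡ 1 ⊎ n₂ ≡ 1
  one-factor-constant {_} {m} {n} {g} {h} {m₁} {n₁} {m₂} {n₂}
    no-zero-divisors prim ρ≡1 0<m support aₘ≉0 aₙ≉0 a≈g⋆h g-spans h-spans
    with ends-agree a≈g⋆h support 0<m aₘ≉0 aₙ≉0 (⋆-spans g-spans h-spans no-zero-divisors)
  ... | refl , refl = Sum.map g-constant h-constant (one-ratio-below-sqrt m₁ n₁ m₂ n₂)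
    where
    instance
      m≢0 : NonZero m
      m≢0 = >-nonZero 0<m
      n≢0 : NonZero n
      n≢0 = >-nonZero (≤-trans 0<m (proj₂ (support m aₘ≉0)))

    monomial-constant : ∀ {f k l} → Spans f k l → l ≤ k → SupportedOnMultiplesOf k (g ⋆ h) → l ≡ 1
    monomial-constant spans l≤k multiples = ≡.trans (≡.sym (≤-antisym (low≤high spans) l≤k))
      (algPrimitive-supportedOnMultiples prim a≈g⋆h multiples)

    g-constant : n₁ ℕ.* n₁ ℕ.* m ≤ m₁ ℕ.* m₁ ℕ.* n → n₁ ≡ 1
    g-constant bound = monomial-constant g-spans n₁≤m₁
      (⋆-supportedOnMultiplesˡ g h (spans-monomial g-spans n₁≤m₁))
      where
      n₁≤m₁ : n₁ ≤ m₁
      n₁≤m₁ = ρ≡1⇒divisor-ratio≤1 ρ≡1 (m∣m*n n₂) (m∣m*n m₂) bound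

    h-constant : n₂ ℕ.* n₂ ℕ.* m ≤ m₂ ℕ.* m₂ ℕ.* n → n₂ ≡ 1
    h-constant bound = monomial-constant h-spans n₂≤m₂
      (⋆-supportedOnMultiplesʳ g h (spans-monomial h-spans n₂≤m₂))
      where
      n₂≤m₂ : n₂ ≤ m₂
      n₂≤m₂ = ρ≡1⇒divisor-ratio≤1 ρ≡1 (n∣m*n n₁) (n∣m*n m₁) bound

proposition2p8 : ∀ {c ℓ} (R : CommutativeRing c ℓ) → IsUFD R →
    (a : ℕ → CommutativeRing.Carrier R) (m n : ℕ) →
    1 ≤ m → m ≤ n →
    ¬ CommutativeRing._≈_ R (CommutativeRing._*_ R (a m) (a n)) (CommutativeRing.0# R) →
    SupportIn R a m n →
    AlgPrimitive R a →
    ρ m n ≡ 1ℚ →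
    DPIrreducible R a
proposition2p8 R ufd a m n 0<m _ aₘaₙ≉0 support prim ρ≡1
  (g , h , g-poly , h-poly , (i , 2≤i , gᵢ≉0) , (i′ , 2≤i′ , hᵢ′≉0) , a≈g⋆h) =
  ¬¬-spans g-poly (<⇒≤ 2≤i) gᵢ≉0 λ (_ , n₁ , _ , i≤n₁ , g-spans) →
  ¬¬-spans h-poly (<⇒≤ 2≤i′) hᵢ′≉0 λ (_ , n₂ , _ , i′≤n₂ , h-spans) →
  [ >⇒≢ (≤-trans 2≤i i≤n₁) , >⇒≢ (≤-trans 2≤i′ i′≤n₂) ]
    (one-factor-constant noZeroDivisors prim ρ≡1 0<m support
       (aₘaₙ≉0 ∘ *-vanishesˡ (a n)) (aₘaₙ≉0 ∘ *-vanishesʳ (a m)) a≈g⋆h g-spans h-spans)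
  where
  open CommutativeRing R using (_*_)
  open DirichletProduct R
  open IsUFD ufd using (noZeroDivisors)
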